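{- Let $\overline{P_n}$ be the complement of the path $P_n$ of order $n\geq 4$. Then $\chi_d^t(M(\overline{P_n}))=4$ if $n=4$, and $\chi_d^t(M(\overline{P_n}))=\lceil n/2\rceil+1$ if $n\geq 5$.
   Context: A total dominator coloring (TDC) of a graph $G$ is a proper coloring of $G$ in which every vertex is adjacent to every vertex of some color class; $\chi_d^t(G)$ is the minimum number of color classes in a TDC of $G$. If $V(G)=\{v_1,\dots,v_n\}$, the Mycielskian $M(G)$ has vertex set $V(G)\cup\{u_1,\dots,u_n\}\cup\{w\}$ and edge set $E(G)\cup\{u_iv_j : v_iv_j\in E(G)\}\cup\{u_iw : 1\le i\le n\}$. -}

module Defs where

open import Data.Nat using (ℕ; _≤_; suc)
open import Data.Fin using (Fin; toℕ)
open import Data.Product using (Σ; ∃; _×_)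
open import Data.Sum using (_⊎_)
open import Relation.Binary.PropositionalEquality using (_≡_; _≢_)
open import Relation.Nullary using (¬_)

record Graph : Set₁ where
  field
    V   : Set
    Adj : V → V → Set
open Graph public

PathAdj : (n : ℕ) → Fin n → Fin n → Set
PathAdj n i j = (toℕ j ≡ suc (toℕ i)) ⊎ (toℕ i ≡ suc (toℕ j))

Path : ℕ → Graph
Path n = record { V = Fin n ; Adj = PathAdj n }

Complement : Graph → Graph
Complement G = record { V = V G ; Adj = λ x y → (x ≢ y) × ¬ (Adj G x y) }

data MycV (A : Set) : Set where
  v : A → MycV A
  u : A → MycV A
  w : MycV A

data MycAdj (G : Graph) : MycV (V G) → MycV (V G) → Set where
  vv : ∀ {i j} → Adj G i j → MycAdj G (v i) (v j)
  uv : ∀ {i j} → Adj G i j → MycAdj G (u i) (v j)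
  vu : ∀ {i j} → Adj G j i → MycAdj G (v i) (u j)
  uw : ∀ {i} → MycAdj G (u i) w
  wu : ∀ {i} → MycAdj G w (u i)

Mycielskian : Graph → Graph
Mycielskian G = record { V = MycV (V G) ; Adj = MycAdj G }

-- A total dominator coloring of G with exactly k (nonempty) color classes:
-- c is surjective onto Fin k, proper, and every vertex is adjacent to
-- every vertex of some color class.
record IsTDC (G : Graph) (k : ℕ) (c : V G → Fin k) : Set where
  field
    surjective : ∀ (a : Fin k) → ∃ λ x → c x ≡ a
    proper     : ∀ x y → Adj G x y → c x ≢ c y
    dominating : ∀ x → ∃ λ (a : Fin k) → ∀ y → c y ≡ a → Adj G x y

HasTDC : Graph → ℕ → Set
HasTDC G k = Σ (V G → Fin k) (IsTDC G k)

TDChromatic≡ : Graph → ℕ → Set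
TDChromatic≡ G k = HasTDC G k × (∀ m → HasTDC G m → k ≤ m)

-- Lower bound: the even vertices 0, 2, 4, … form a clique of size ⌈ n /2⌉ in the complement of P_n,
-- and in any proper colouring of a Mycielskian a k-clique needs k colours besides that of w.
-- Upper bound (n ≥ 5): colour v i by ⌊ i /2⌋, every u i by a new colour and w by 1; vertices
-- i ≤ 2 are dominated by the class of v 4, the others by that of v 0, and w by the shadows.
-- For n = 4 there is no v 4, so one more colour is needed, and a case analysis rules out three.
module Submission where

open import Defs
open import Data.Nat using (ℕ; suc; _≤_; _<_; _+_; ⌈_/2⌉; ⌊_/2⌋; z≤n; s≤s; s≤s⁻¹; s<s⁻¹; _≤?_)
open import Data.Nat.Properties
  using (≤-trans; ≤-refl; <⇒≤; <⇒≢; >⇒≢; <⇒≱; ≰⇒>; <-irrefl; <-asym; n≤1+n; m<n⇒m<1+n;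
         m≤n⇒m<n∨m≡n; +-mono-≤; +-suc; +-comm; ⌊n/2⌋-mono; ⌈n/2⌉-mono; n≡⌊n+n/2⌋; n≡⌈n+n/2⌉)
open import Data.Fin using (Fin; toℕ; fromℕ<; zero; suc)
open import Data.Fin.Properties
  using (toℕ-injective; toℕ-fromℕ<; toℕ<n; punchOut-injective; injective⇒≤; _≟_)
  renaming (<-cmp to <-cmpᶠ)
open import Data.Product using (_×_; ∃; _,_; proj₁; proj₂)
open import Data.Sum using (_⊎_; inj₁; inj₂; [_,_])
open import Data.Empty using (⊥)
open import Function using (_∘_)
open import Relation.Binary.Definitions using (tri<; tri≈; tri>)
open import Relation.Nullary using (¬_; yes; no; contradiction)
open import Relation.Binary.PropositionalEquality using (_≡_; _≢_; refl; sym; trans; cong; subst; ≢-sym)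

⌊n/2⌋-reflects-< : ∀ {m n} → ⌊ m /2⌋ < ⌊ n /2⌋ → m < n
⌊n/2⌋-reflects-< lt = ≰⇒> (λ n≤m → <⇒≱ lt (⌊n/2⌋-mono n≤m))

2+m≤n⇒⌊m/2⌋<⌊n/2⌋ : ∀ {m n} → 2 + m ≤ n → ⌊ m /2⌋ < ⌊ n /2⌋
2+m≤n⇒⌊m/2⌋<⌊n/2⌋ = ⌊n/2⌋-mono

2+m≤n⇒⌈m/2⌉<⌈n/2⌉ : ∀ {m n} → 2 + m ≤ n → ⌈ m /2⌉ < ⌈ n /2⌉
2+m≤n⇒⌈m/2⌉<⌈n/2⌉ = ⌈n/2⌉-mono

m<⌈n/2⌉⇒m+m<n : ∀ {m n} → m < ⌈ n /2⌉ → m + m < n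
m<⌈n/2⌉⇒m+m<n {m} m<n/2 = s<s⁻¹ (⌊n/2⌋-reflects-< (subst (_< ⌈ _ /2⌉) (n≡⌈n+n/2⌉ m) m<n/2))

m<n⇒2+[m+m]≤n+n : ∀ {m n} → m < n → 2 + (m + m) ≤ n + n
m<n⇒2+[m+m]≤n+n {m} {n} m<n = subst (_≤ n + n) (cong suc (+-suc m m)) (+-mono-≤ m<n m<n)

m<n∧n≢1+m⇒2+m≤n : ∀ {m n} → m < n → n ≢ suc m → 2 + m ≤ n
m<n∧n≢1+m⇒2+m≤n m<n n≢1+m = [ (λ lt → lt) , (λ eq → contradiction (sym eq) n≢1+m) ] (m≤n⇒m<n∨m≡n m<n)

Fin2-other : ∀ {x y z : Fin 2} → x ≢ y → z ≢ x → z ≡ y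
Fin2-other {zero}     {zero}                  x≢y _   = contradiction refl x≢y
Fin2-other {suc zero} {suc zero}              x≢y _   = contradiction refl x≢y
Fin2-other {zero}     {suc zero} {zero}       _   z≢x = contradiction refl z≢x
Fin2-other {zero}     {suc zero} {suc zero}   _   _   = refl
Fin2-other {suc zero} {zero}     {zero}       _   _   = refl
Fin2-other {suc zero} {zero}     {suc zero}   _   z≢x = contradiction refl z≢x

Fin3-third : ∀ {p q r z : Fin 3} → p ≢ q → p ≢ r → q ≢ r → z ≢ p → z ≢ q → z ≡ r
Fin3-third p≢q p≢r q≢r z≢p z≢q =
  punchOut-injective (≢-sym z≢p) p≢r
    (Fin2-other (q≢r ∘ punchOut-injective p≢q p≢r) (z≢q ∘ punchOut-injective (≢-sym z≢p) p≢q))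

Fin3-cover : ∀ {p q r : Fin 3} → p ≢ q → p ≢ r → q ≢ r → ∀ z → z ≡ p ⊎ z ≡ q ⊎ z ≡ r
Fin3-cover {p} {q} p≢q p≢r q≢r z with z ≟ p | z ≟ q
... | yes z≡p | _       = inj₁ z≡p
... | no _    | yes z≡q = inj₂ (inj₁ z≡q)
... | no z≢p  | no z≢q  = inj₂ (inj₂ (Fin3-third p≢q p≢r q≢r z≢p z≢q))

PathComplement : ℕ → Graph
PathComplement n = Complement (Path n)

module _ {n : ℕ} where

  PathComplement-sym : ∀ {i j : Fin n} → Adj (PathComplement n) i j → Adj (PathComplement n) j i
  PathComplement-sym (i≢j , ¬i~j) = ≢-sym i≢j , ¬i~j ∘ [ inj₂ , inj₁ ]

  far⇒PathComplement : ∀ {i j : Fin n} → 2 + toℕ i ≤ toℕ j → Adj (PathComplement n) i j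
  far⇒PathComplement {i} {j} far =
      (λ i≡j → <-irrefl (cong toℕ i≡j) i<j)
    , [ (λ j≡1+i → <-irrefl (sym j≡1+i) far) , (λ i≡1+j → <-asym i<j (subst (_ <_) (sym i≡1+j) ≤-refl)) ]
    where
    i<j : toℕ i < toℕ j
    i<j = ≤-trans (n≤1+n _) far

  PathComplement⇒far : ∀ {i j : Fin n} → Adj (PathComplement n) i j →
                       2 + toℕ i ≤ toℕ j ⊎ 2 + toℕ j ≤ toℕ i
  PathComplement⇒far {i} {j} (i≢j , ¬i~j) with <-cmpᶠ i j
  ... | tri< i<j _ _ = inj₁ (m<n∧n≢1+m⇒2+m≤n i<j (¬i~j ∘ inj₁))
  ... | tri≈ _ i≡j _ = contradiction i≡j i≢j
  ... | tri> _ _ j<i = inj₂ (m<n∧n≢1+m⇒2+m≤n j<i (¬i~j ∘ inj₂))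

module _ {G : Graph} {m : ℕ} {c : MycV (V G) → Fin m}
         (proper : ∀ x y → MycAdj G x y → c x ≢ c y) where

  -- Every vertex j of a clique contributes a colour other than c w: that of v j, or that of
  -- its shadow u j if v j has the colour of w. Distinct clique vertices contribute distinct colours.
  data Representative (j : V G) : Fin m → Set where
    own    : c (v j) ≢ c w → Representative j (c (v j))
    shadow : c (v j) ≡ c w → Representative j (c (u j))

  representative : ∀ j → ∃ (Representative j)
  representative j with c (v j) ≟ c w
  ... | yes vj≡w = c (u j) , shadow vj≡w
  ... | no  vj≢w = c (v j) , own vj≢w

  representative-≢-w : ∀ {j b} → Representative j b → b ≢ c w
  representative-≢-w (own vj≢w)  = vj≢w
  representative-≢-w (shadow _)  = proper _ _ uw

  representatives-distinct : ∀ {i j a b} → Adj G i j → Adj G j i →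
                             Representative i a → Representative j b → a ≢ b
  representatives-distinct i~j j~i (own _)       (own _)       = proper _ _ (vv i~j)
  representatives-distinct i~j j~i (own _)       (shadow _)    = proper _ _ (vu j~i)
  representatives-distinct i~j j~i (shadow _)    (own _)       = proper _ _ (uv i~j)
  representatives-distinct i~j j~i (shadow vi≡w) (shadow vj≡w) _ =
    proper _ _ (vv i~j) (trans vi≡w (sym vj≡w))

  clique<Mycielskian-colours : ∀ {k} (ι : Fin k → V G) →
                               (∀ {x y} → x ≢ y → Adj G (ι x) (ι y)) → k < m
  clique<Mycielskian-colours {k} ι clique = injective⇒≤ colour-injective
    where
    colour : Fin (suc k) → Fin m
    colour zero    = c w
    colour (suc x) = proj₁ (representative (ι x))

    colour-injective : ∀ {x y} → colour x ≡ colour y → x ≡ y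
    colour-injective {zero}  {zero}  _  = refl
    colour-injective {zero}  {suc y} eq = contradiction (sym eq) (representative-≢-w (proj₂ (representative (ι y))))
    colour-injective {suc x} {zero}  eq = contradiction eq (representative-≢-w (proj₂ (representative (ι x))))
    colour-injective {suc x} {suc y} eq with x ≟ y
    ... | yes x≡y = cong suc x≡y
    ... | no  x≢y = contradiction eq
          (representatives-distinct (clique x≢y) (clique (≢-sym x≢y))
            (proj₂ (representative (ι x))) (proj₂ (representative (ι y))))

module _ {n : ℕ} where

  evens : Fin ⌈ n /2⌉ → Fin n
  evens x = fromℕ< (m<⌈n/2⌉⇒m+m<n (toℕ<n x))

  toℕ-evens : ∀ x → toℕ (evens x) ≡ toℕ x + toℕ x
  toℕ-evens x = toℕ-fromℕ< (m<⌈n/2⌉⇒m+m<n (toℕ<n x))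

  ⌊evens/2⌋ : ∀ x → ⌊ toℕ (evens x) /2⌋ ≡ toℕ x
  ⌊evens/2⌋ x = trans (cong ⌊_/2⌋ (toℕ-evens x)) (sym (n≡⌊n+n/2⌋ (toℕ x)))

  evens-far : ∀ {x y} → toℕ x < toℕ y → 2 + toℕ (evens x) ≤ toℕ (evens y)
  evens-far {x} {y} x<y rewrite toℕ-evens x | toℕ-evens y = m<n⇒2+[m+m]≤n+n x<y

  evens-clique : ∀ {x y} → x ≢ y → Adj (PathComplement n) (evens x) (evens y)
  evens-clique {x} {y} x≢y with <-cmpᶠ x y
  ... | tri< x<y _ _ = far⇒PathComplement (evens-far x<y)
  ... | tri≈ _ x≡y _ = contradiction x≡y x≢y
  ... | tri> _ _ y<x = PathComplement-sym (far⇒PathComplement (evens-far y<x))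

TDC-lower-bound : ∀ n m → HasTDC (Mycielskian (PathComplement n)) m → ⌈ n /2⌉ + 1 ≤ m
TDC-lower-bound n m (c , tdc) =
  subst (_≤ m) (+-comm 1 ⌈ n /2⌉) (clique<Mycielskian-colours (IsTDC.proper tdc) evens evens-clique)

ℕ-colouring⇒HasTDC : ∀ (G : Graph) k (f : V G → ℕ) → (∀ x → f x < k) →
                     (∀ b → b < k → ∃ λ x → f x ≡ b) →
                     (∀ x y → Adj G x y → f x ≢ f y) →
                     (∀ x → ∃ λ z → ∀ y → f y ≡ f z → Adj G x y) →
                     HasTDC G k
ℕ-colouring⇒HasTDC G k f f<k hits separates dominates = c , record
  { surjective = λ a → let (x , fx≡a) = hits (toℕ a) (toℕ<n a) in
                       x , toℕ-injective (trans (toℕ-fromℕ< (f<k x)) fx≡a)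
  ; proper     = λ x y x~y → separates x y x~y ∘ c-reflects
  ; dominating = λ x → let (z , dom) = dominates x in c z , λ y → dom y ∘ c-reflects
  }
  where
  c : V G → Fin k
  c x = fromℕ< (f<k x)

  c-reflects : ∀ {x y} → c x ≡ c y → f x ≡ f y
  c-reflects {x} {y} eq = trans (sym (toℕ-fromℕ< (f<k x))) (trans (cong toℕ eq) (toℕ-fromℕ< (f<k y)))

module FloorColouring (n : ℕ) (5≤n : 5 ≤ n) where

  K : ℕ
  K = ⌈ n /2⌉

  2<K : 2 < K
  2<K = ⌈n/2⌉-mono 5≤n

  1<K : 1 < K
  1<K = ≤-trans (s≤s (s≤s z≤n)) 2<K

  0<n : 0 < n
  0<n = ≤-trans (s≤s z≤n) 5≤n

  v₀ v₄ : MycV (Fin n)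
  v₀ = v (fromℕ< 0<n)
  v₄ = v (fromℕ< 5≤n)

  colour : MycV (Fin n) → ℕ
  colour (v i) = ⌊ toℕ i /2⌋
  colour (u _) = K
  colour w     = 1

  ⌊/2⌋<K : ∀ (i : Fin n) → ⌊ toℕ i /2⌋ < K
  ⌊/2⌋<K i = ⌈n/2⌉-mono (toℕ<n i)

  colour<1+K : ∀ x → colour x < suc K
  colour<1+K (v i) = m<n⇒m<1+n (⌊/2⌋<K i)
  colour<1+K (u _) = ≤-refl
  colour<1+K w     = s≤s (<⇒≤ 1<K)

  hits : ∀ b → b < suc K → ∃ λ x → colour x ≡ b
  hits b b<1+K with m≤n⇒m<n∨m≡n (s≤s⁻¹ b<1+K)
  ... | inj₂ refl = u (fromℕ< 0<n) , refl
  ... | inj₁ b<K  = v (evens (fromℕ< b<K)) , trans (⌊evens/2⌋ (fromℕ< b<K)) (toℕ-fromℕ< b<K)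

  separates : ∀ x y → MycAdj (PathComplement n) x y → colour x ≢ colour y
  separates (v i) (v j) (vv i~j) with PathComplement⇒far i~j
  ... | inj₁ far = <⇒≢ (2+m≤n⇒⌊m/2⌋<⌊n/2⌋ far)
  ... | inj₂ far = >⇒≢ (2+m≤n⇒⌊m/2⌋<⌊n/2⌋ far)
  separates (u i) (v j) (uv _) = >⇒≢ (⌊/2⌋<K j)
  separates (v i) (u j) (vu _) = <⇒≢ (⌊/2⌋<K i)
  separates (u i) w     uw     = >⇒≢ 1<K
  separates w     (u i) wu     = <⇒≢ 1<K

  colour≡2 : ∀ y → colour y ≡ 2 → ∃ λ j → y ≡ v j × 4 ≤ toℕ j
  colour≡2 (v j) eq = j , refl , ⌊n/2⌋-reflects-< {3} (subst (1 <_) (sym eq) ≤-refl)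
  colour≡2 (u _) eq = contradiction eq (>⇒≢ 2<K)
  colour≡2 w     ()

  colour≡0 : ∀ y → colour y ≡ 0 → ∃ λ j → y ≡ v j × toℕ j < 2
  colour≡0 (v j) eq = j , refl , ⌊n/2⌋-reflects-< {n = 2} (subst (_< 1) (sym eq) ≤-refl)
  colour≡0 (u _) eq = contradiction eq (>⇒≢ (<⇒≤ 1<K))
  colour≡0 w     ()

  dominates-via-neighbours : ∀ i x → (∀ {j} → Adj (PathComplement n) i j → MycAdj (PathComplement n) x (v j)) →
                             ∃ λ z → ∀ y → colour y ≡ colour z → MycAdj (PathComplement n) x y
  dominates-via-neighbours i x i~j⇒x~vj with toℕ i ≤? 2
  ... | yes i≤2 = v₄ , λ y eq → high y (colour≡2 y (trans eq (cong ⌊_/2⌋ (toℕ-fromℕ< 5≤n))))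
    where
    high : ∀ y → ∃ (λ j → y ≡ v j × 4 ≤ toℕ j) → MycAdj (PathComplement n) x y
    high _ (j , refl , 4≤j) = i~j⇒x~vj (far⇒PathComplement (≤-trans (s≤s (s≤s i≤2)) 4≤j))
  ... | no  i≰2 = v₀ , λ y eq → low y (colour≡0 y (trans eq (cong ⌊_/2⌋ (toℕ-fromℕ< 0<n))))
    where
    low : ∀ y → ∃ (λ j → y ≡ v j × toℕ j < 2) → MycAdj (PathComplement n) x y
    low _ (j , refl , j<2) = i~j⇒x~vj (PathComplement-sym (far⇒PathComplement (≤-trans (s≤s j<2) (≰⇒> i≰2))))

  dominates : ∀ x → ∃ λ z → ∀ y → colour y ≡ colour z → MycAdj (PathComplement n) x y
  dominates (v i) = dominates-via-neighbours i (v i) vv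
  dominates (u i) = dominates-via-neighbours i (u i) uv
  dominates w     = u (fromℕ< 0<n) , λ
    { (v j) eq → contradiction eq (<⇒≢ (⌊/2⌋<K j))
    ; (u j) _  → wu
    ; w     eq → contradiction eq (<⇒≢ 1<K)
    }

  hasTDC : HasTDC (Mycielskian (PathComplement n)) (⌈ n /2⌉ + 1)
  hasTDC = subst (HasTDC (Mycielskian (PathComplement n))) (+-comm 1 K)
    (ℕ-colouring⇒HasTDC _ _ colour colour<1+K hits separates dominates)

pattern 0F = zero
pattern 1F = suc zero
pattern 2F = suc (suc zero)
pattern 3F = suc (suc (suc zero))

-- With n = 4 no vertex has ⌊ i /2⌋ = 2; rounding up instead gives v 3 a class of its own,
-- which dominates v 0 and v 1, at the price of a fourth colour.
module CeilingColouring where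

  colour : MycV (Fin 4) → ℕ
  colour (v i) = ⌈ toℕ i /2⌉
  colour (u _) = 3
  colour w     = 1

  ⌈/2⌉≤2 : ∀ (i : Fin 4) → ⌈ toℕ i /2⌉ ≤ 2
  ⌈/2⌉≤2 i = ⌈n/2⌉-mono (s≤s⁻¹ (toℕ<n i))

  colour<4 : ∀ x → colour x < 4
  colour<4 (v i) = m<n⇒m<1+n (s≤s (⌈/2⌉≤2 i))
  colour<4 (u _) = ≤-refl
  colour<4 w     = s≤s (s≤s z≤n)

  hits : ∀ b → b < 4 → ∃ λ x → colour x ≡ b
  hits 0 _ = v 0F , refl
  hits 1 _ = w , refl
  hits 2 _ = v 3F , refl
  hits 3 _ = u 0F , refl
  hits (suc (suc (suc (suc _)))) (s≤s (s≤s (s≤s (s≤s ()))))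

  separates : ∀ x y → MycAdj (PathComplement 4) x y → colour x ≢ colour y
  separates (v i) (v j) (vv i~j) with PathComplement⇒far i~j
  ... | inj₁ far = <⇒≢ (2+m≤n⇒⌈m/2⌉<⌈n/2⌉ far)
  ... | inj₂ far = >⇒≢ (2+m≤n⇒⌈m/2⌉<⌈n/2⌉ far)
  separates (u i) (v j) (uv _) = >⇒≢ (s≤s (⌈/2⌉≤2 j))
  separates (v i) (u j) (vu _) = <⇒≢ (s≤s (⌈/2⌉≤2 i))
  separates (u i) w     uw     = λ ()
  separates w     (u i) wu     = λ ()

  colour≡2 : ∀ y → colour y ≡ 2 → ∃ λ j → y ≡ v j × 3 ≤ toℕ j
  colour≡2 (v j) eq = j , refl , s≤s⁻¹ (⌊n/2⌋-reflects-< {3} (subst (1 <_) (sym eq) ≤-refl))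
  colour≡2 (u _) ()
  colour≡2 w     ()

  colour≡0 : ∀ y → colour y ≡ 0 → ∃ λ j → y ≡ v j × toℕ j < 1
  colour≡0 (v j) eq = j , refl , s<s⁻¹ (⌊n/2⌋-reflects-< {n = 2} (subst (_< 1) (sym eq) ≤-refl))
  colour≡0 (u _) ()
  colour≡0 w     ()

  dominates-via-neighbours : ∀ i x → (∀ {j} → Adj (PathComplement 4) i j → MycAdj (PathComplement 4) x (v j)) →
                             ∃ λ z → ∀ y → colour y ≡ colour z → MycAdj (PathComplement 4) x y
  dominates-via-neighbours i x i~j⇒x~vj with toℕ i ≤? 1
  ... | yes i≤1 = v 3F , λ y → high y ∘ colour≡2 y
    where
    high : ∀ y → ∃ (λ j → y ≡ v j × 3 ≤ toℕ j) → MycAdj (PathComplement 4) x y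
    high _ (j , refl , 3≤j) = i~j⇒x~vj (far⇒PathComplement (≤-trans (s≤s (s≤s i≤1)) 3≤j))
  ... | no  i≰1 = v 0F , λ y → low y ∘ colour≡0 y
    where
    low : ∀ y → ∃ (λ j → y ≡ v j × toℕ j < 1) → MycAdj (PathComplement 4) x y
    low _ (j , refl , j<1) = i~j⇒x~vj (PathComplement-sym (far⇒PathComplement (≤-trans (s≤s j<1) (≰⇒> i≰1))))

  dominates : ∀ x → ∃ λ z → ∀ y → colour y ≡ colour z → MycAdj (PathComplement 4) x y
  dominates (v i) = dominates-via-neighbours i (v i) vv
  dominates (u i) = dominates-via-neighbours i (u i) uv
  dominates w     = u 0F , λ
    { (v j) eq → contradiction eq (<⇒≢ (s≤s (⌈/2⌉≤2 j)))
    ; (u j) _  → wu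
    ; w     ()
    }

  hasTDC : HasTDC (Mycielskian (PathComplement 4)) 4
  hasTDC = ℕ-colouring⇒HasTDC _ _ colour colour<4 hits separates dominates

no-rainbow-non-neighbours : ∀ {G c} → IsTDC G 3 c → ∀ x {y₁ y₂ y₃} →
                            c y₁ ≢ c y₂ → c y₁ ≢ c y₃ → c y₂ ≢ c y₃ →
                            ¬ Adj G x y₁ → ¬ Adj G x y₂ → ¬ Adj G x y₃ → ⊥
no-rainbow-non-neighbours tdc x {y₁} {y₂} {y₃} c₁≢c₂ c₁≢c₃ c₂≢c₃ ¬x~y₁ ¬x~y₂ ¬x~y₃
  with IsTDC.dominating tdc x
... | b , dom with Fin3-cover c₁≢c₂ c₁≢c₃ c₂≢c₃ b
...   | inj₁ b≡c₁        = ¬x~y₁ (dom y₁ (sym b≡c₁))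
...   | inj₂ (inj₁ b≡c₂) = ¬x~y₂ (dom y₂ (sym b≡c₂))
...   | inj₂ (inj₂ b≡c₃) = ¬x~y₃ (dom y₃ (sym b≡c₃))

0~2 : Adj (PathComplement 4) 0F 2F
0~2 = far⇒PathComplement ≤-refl

0~3 : Adj (PathComplement 4) 0F 3F
0~3 = far⇒PathComplement (s≤s (s≤s z≤n))

1~3 : Adj (PathComplement 4) 1F 3F
1~3 = far⇒PathComplement ≤-refl

-- The class a dominating w contains only shadows, so the v's are 2-coloured along the path
-- 2 ~ 0 ~ 3 ~ 1; then v 1 or v 2 has non-neighbours of all three colours.
module NoThreeColouring {c : MycV (Fin 4) → Fin 3}
                        (tdc : IsTDC (Mycielskian (PathComplement 4)) 3 c) where
  open IsTDC tdc

  a : Fin 3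
  a = proj₁ (dominating w)

  w≢a : c w ≢ a
  w≢a eq = contradiction (proj₂ (dominating w) w eq) λ ()

  v≢a : ∀ j → c (v j) ≢ a
  v≢a j eq = contradiction (proj₂ (dominating w) (v j) eq) λ ()

  ¬v~u-self : ∀ {i} → ¬ MycAdj (PathComplement 4) (v i) (u i)
  ¬v~u-self (vu (i≢i , _)) = i≢i refl

  v₀≡w⇒⊥ : c (v 0F) ≡ c w → ⊥
  v₀≡w⇒⊥ v₀≡w = no-rainbow-non-neighbours tdc (v 1F) {u 1F} {w} {v 2F}
    (proper _ _ uw) (λ eq → proper _ _ (uv 1~3) (trans eq v₂≡v₃)) (≢-sym v₂≢w)
    ¬v~u-self (λ ()) (λ { (vv (_ , ¬1-2)) → ¬1-2 (inj₁ refl) })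
    where
    v₂≢w : c (v 2F) ≢ c w
    v₂≢w eq = proper _ _ (vv 0~2) (trans v₀≡w (sym eq))

    v₂≡v₃ : c (v 2F) ≡ c (v 3F)
    v₂≡v₃ = Fin3-third (≢-sym w≢a) (≢-sym (v≢a 3F)) (proper _ _ (vv 0~3) ∘ trans v₀≡w) (v≢a 2F) v₂≢w

  v₀≢w⇒⊥ : c (v 0F) ≢ c w → ⊥
  v₀≢w⇒⊥ v₀≢w = no-rainbow-non-neighbours tdc (v 2F) {u 2F} {w} {v 1F}
    (proper _ _ uw) (λ eq → proper _ _ (uv (PathComplement-sym 0~2)) (trans eq v₁≡v₀))
    (λ eq → v₀≢w (trans (sym v₁≡v₀) (sym eq)))
    ¬v~u-self (λ ()) (λ { (vv (_ , ¬2-1)) → ¬2-1 (inj₂ refl) })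
    where
    v₃≡w : c (v 3F) ≡ c w
    v₃≡w = Fin3-third (≢-sym (v≢a 0F)) (≢-sym w≢a) v₀≢w (v≢a 3F) (≢-sym (proper _ _ (vv 0~3)))

    v₁≡v₀ : c (v 1F) ≡ c (v 0F)
    v₁≡v₀ = Fin3-third (≢-sym w≢a) (≢-sym (v≢a 0F)) (≢-sym v₀≢w) (v≢a 1F)
              (λ eq → proper _ _ (vv 1~3) (trans eq (sym v₃≡w)))

  impossible : ⊥
  impossible with c (v 0F) ≟ c w
  ... | yes v₀≡w = v₀≡w⇒⊥ v₀≡w
  ... | no  v₀≢w = v₀≢w⇒⊥ v₀≢w

no-TDC-with-three-colours : ¬ HasTDC (Mycielskian (PathComplement 4)) 3
no-TDC-with-three-colours (_ , tdc) = NoThreeColouring.impossible tdc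

TDC-lower-bound-4 : ∀ m → HasTDC (Mycielskian (PathComplement 4)) m → 4 ≤ m
TDC-lower-bound-4 m tdc with m≤n⇒m<n∨m≡n (TDC-lower-bound 4 m tdc)
... | inj₁ 3<m  = 3<m
... | inj₂ refl = contradiction tdc no-TDC-with-three-colours

proposition3p9 : ∀ (n : ℕ) → 4 ≤ n →
    (n ≡ 4 → TDChromatic≡ (Mycielskian (Complement (Path n))) 4)
    × (5 ≤ n → TDChromatic≡ (Mycielskian (Complement (Path n))) (⌈ n /2⌉ + 1))
proposition3p9 n _ =
    (λ { refl → CeilingColouring.hasTDC , TDC-lower-bound-4 })
  , (λ 5≤n → FloorColouring.hasTDC n 5≤n , TDC-lower-bound n)
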